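{- Let $C\subseteq\mathbb{F}_q^n$ be a constant weight linear code. Let $C'$ be a subcode of $C$ and $c\in C$ a codeword. Then $c\in C'$ if and only if $\mathrm{Supp}(c)\subseteq\mathrm{Supp}(C')$.
   Context: A subcode is a linear subspace of $C$. For a subcode $D$, $\mathrm{Supp}(D)=\{x\in\{1,\dots,n\}: \exists\, d\in D,\ d_x\neq0\}$, and $\mathrm{Supp}(c)=\{x: c_x\neq 0\}$. $C$ is of constant weight if all its nonzero codewords have the same number of nonzero coordinates. -}

module Defs where

open import Level using (Level; _⊔_; suc)
open import Data.Nat using (ℕ; zero) renaming (suc to sucℕ; _+_ to _+ℕ_)
open import Data.Fin using (Fin) renaming (zero to fzero; suc to fsuc)
open import Data.Product using (Σ; ∃; _×_; _,_)
open import Relation.Nullary using (¬_; does)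
open import Relation.Binary using (Decidable)
open import Data.Bool using (if_then_else_)
open import Algebra.Bundles using (CommutativeRing)
open import Relation.Binary.PropositionalEquality using (_≡_)

-- A finite field F_q: a commutative ring with 0 ≠ 1, multiplicative inverses
-- of nonzero elements, decidable equality, and a surjective enumeration
-- by Fin q (so the carrier has at most q elements up to ≈).
record FiniteField (c ℓ : Level) : Set (suc (c ⊔ ℓ)) where
  field
    commRing : CommutativeRing c ℓ
  open CommutativeRing commRing public
  field
    0≉1     : ¬ (0# ≈ 1#)
    inverse : ∀ x → ¬ (x ≈ 0#) → Σ Carrier (λ y → (x * y) ≈ 1#)
    _≟_     : Decidable _≈_
    q       : ℕ
    enum    : Fin q → Carrier
    enum-surjective : ∀ x → ∃ λ i → enum i ≈ x

module _ {c ℓ : Level} (F : FiniteField c ℓ) where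
  open FiniteField F

  Word : ℕ → Set c
  Word n = Fin n → Carrier

  record IsLinearCode {n : ℕ} {ℓc : Level} (C : Word n → Set ℓc) : Set (c ⊔ ℓ ⊔ ℓc) where
    field
      respects : ∀ {u v} → (∀ i → u i ≈ v i) → C u → C v
      zero∈    : C (λ _ → 0#)
      +-closed : ∀ {u v} → C u → C v → C (λ i → u i + v i)
      ·-closed : ∀ a {u} → C u → C (λ i → a * u i)

  record IsSubcode {n : ℕ} {ℓc ℓd : Level} (D : Word n → Set ℓd) (C : Word n → Set ℓc)
      : Set (c ⊔ ℓ ⊔ ℓc ⊔ ℓd) where
    field
      linear : IsLinearCode D
      ⊆C     : ∀ {u} → D u → C u

  Supp : {n : ℕ} → Word n → Fin n → Set ℓ
  Supp u x = ¬ (u x ≈ 0#)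

  SuppCode : {n : ℕ} {ℓd : Level} → (Word n → Set ℓd) → Fin n → Set (c ⊔ ℓ ⊔ ℓd)
  SuppCode D x = Σ (Word _) (λ d → D d × ¬ (d x ≈ 0#))

  wt : {n : ℕ} → Word n → ℕ
  wt {zero}   u = 0
  wt {sucℕ n} u = (if does (u fzero ≟ 0#) then 0 else 1) +ℕ wt (λ i → u (fsuc i))

  IsNonzero : {n : ℕ} → Word n → Set ℓ
  IsNonzero {n} u = ¬ (∀ i → u i ≈ 0#)

  IsConstantWeight : {n : ℕ} {ℓc : Level} → (Word n → Set ℓc) → Set (c ⊔ ℓ ⊔ ℓc)
  IsConstantWeight C = ∀ {u v} → C u → C v → IsNonzero u → IsNonzero v → wt u ≡ wt v

-- Pick codewords g₁, …, g_k of C′ one at a time, each with a nonzero coordinate outside the union S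
-- of the supports of the earlier ones, until S contains Supp u.  By induction on k, every v ∈ C
-- either has no nonzero coordinate outside S and lies in C′, or has wt_S(v) · q^k = w, where wt_S
-- counts nonzero coordinates outside S and w is the common weight.  For the step, look at the q
-- translates v + l·g: if one of them vanishes outside S then v ∈ C′; otherwise each has
-- wt_S · q^k = w, and counting the nonzero coordinates of all translates together with g gives
-- q·w + w = q·w + wt_{S ∪ Supp g}(v) · q^(k+1).

module Submission where

open import Defs
open import Level using (Level; _⊔_)
open import Function using (_∘_; _⇔_; mk⇔)
open import Data.Bool using (Bool; true; false; not; _∨_; if_then_else_)
open import Data.Product using (Σ; _×_; _,_)
open import Data.Sum using (_⊎_; inj₁; inj₂)
open import Data.Nat as ℕ using (ℕ; zero; suc; _+_; _*_; _^_)
import Data.Nat.Properties as ℕₚ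
open ℕₚ using (+-*-semiring)
open import Algebra.Properties.Semiring.Sum +-*-semiring
  using (sum-syntax; sum-cong-≗; sum-replicate-zero; ∑-comm; ∑-distrib-+; *-distribˡ-sum; *-distribʳ-sum)
open import Data.Fin using (Fin; zero; suc)
open import Data.Fin.Properties using (any?)
open import Data.List using (List; []; _∷_; length; lookup; map; allFin; deduplicate)
open import Data.List.Relation.Unary.All as All using (All; []; _∷_)
open import Data.List.Relation.Unary.Any using (here; there)
open import Data.List.Relation.Unary.AllPairs using (_∷_)
open import Data.List.Membership.Propositional.Properties using (∈-allFin)
import Data.List.Membership.Setoid
import Data.List.Membership.Setoid.Properties as SetoidMembership
import Data.List.Relation.Unary.Unique.Setoid
open import Data.List.Relation.Unary.Unique.DecSetoid.Properties using (deduplicate-!)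
open import Data.List.Relation.Unary.Enumerates.Setoid.Properties using (deduplicate⁺)
open import Relation.Nullary using (¬_; does; yes; no; contradiction)
open import Relation.Nullary.Decidable using (dec-true; dec-false; does-⇔)
open import Relation.Binary.Bundles using (DecSetoid)
import Relation.Binary.PropositionalEquality as ≡
open ≡ using (_≡_; _≢_; refl; cong; cong₂; module ≡-Reasoning)

∑-const : ∀ n c → ∑[ i < n ] c ≡ n * c
∑-const zero    c = refl
∑-const (suc n) c = cong (c +_) (∑-const n c)

∑-zero : ∀ {n} {f : Fin n → ℕ} → (∀ i → f i ≡ 0) → ∑[ i < n ] f i ≡ 0
∑-zero {n} f≡0 = ≡.trans (sum-cong-≗ f≡0) (sum-replicate-zero n)

∑≡0⇒ : ∀ {n} (f : Fin n → ℕ) → ∑[ i < n ] f i ≡ 0 → ∀ i → f i ≡ 0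
∑≡0⇒ f eq zero    = ℕₚ.m+n≡0⇒m≡0 (f zero) eq
∑≡0⇒ f eq (suc i) = ∑≡0⇒ (f ∘ suc) (ℕₚ.m+n≡0⇒n≡0 (f zero) eq) i

module Counting {a ℓ} (D : DecSetoid a ℓ) where
  open DecSetoid D using (_≈_; _≟_; setoid; sym; trans) renaming (Carrier to A)
  open Data.List.Membership.Setoid setoid using (_∈_)
  open Data.List.Relation.Unary.Unique.Setoid setoid using (Unique)

  ⟦_≉_⟧ : A → A → ℕ
  ⟦ x ≉ y ⟧ = if does (x ≟ y) then 0 else 1

  ⟦≉⟧-congˡ : ∀ {x x′ y} → x ≈ x′ → ⟦ x ≉ y ⟧ ≡ ⟦ x′ ≉ y ⟧
  ⟦≉⟧-congˡ x≈x′ = cong (λ b → if b then 0 else 1)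
    (does-⇔ (mk⇔ (trans (sym x≈x′)) (trans x≈x′)) (_ ≟ _) (_ ≟ _))

  ⟦≈⟧ : ∀ {x y} → x ≈ y → ⟦ x ≉ y ⟧ ≡ 0
  ⟦≈⟧ x≈y = cong (λ b → if b then 0 else 1) (dec-true (_ ≟ _) x≈y)

  ⟦≉⟧ : ∀ {x y} → ¬ x ≈ y → ⟦ x ≉ y ⟧ ≡ 1
  ⟦≉⟧ x≉y = cong (λ b → if b then 0 else 1) (dec-false (_ ≟ _) x≉y)

  ⟦≉⟧≡0⇒≈ : ∀ {x y} → ⟦ x ≉ y ⟧ ≡ 0 → x ≈ y
  ⟦≉⟧≡0⇒≈ {x} {y} eq with x ≟ y
  ... | yes x≈y = x≈y
  ⟦≉⟧≡0⇒≈ () | no _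

  ∑-⟦≉⟧-all : ∀ {t} xs → All (λ y → ¬ y ≈ t) xs → ∑[ i < length xs ] ⟦ lookup xs i ≉ t ⟧ ≡ length xs
  ∑-⟦≉⟧-all []       []         = refl
  ∑-⟦≉⟧-all (x ∷ xs) (x≉t ∷ ≉t) = cong₂ _+_ (⟦≉⟧ x≉t) (∑-⟦≉⟧-all xs ≉t)

  ∑-⟦≉⟧-unique : ∀ {t} xs → Unique xs → t ∈ xs →
                 (∑[ i < length xs ] ⟦ lookup xs i ≉ t ⟧) + 1 ≡ length xs
  ∑-⟦≉⟧-unique {t} (x ∷ xs) (x≉xs ∷ !xs) t∈ with x ≟ t
  ... | yes x≈t = ≡.trans (ℕₚ.+-comm _ 1) (cong suc (∑-⟦≉⟧-all xs (All.map ≉t x≉xs)))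
    where
    ≉t : ∀ {y} → ¬ x ≈ y → ¬ y ≈ t
    ≉t x≉y y≈t = x≉y (trans x≈t (sym y≈t))
  ... | no x≉t = cong suc (∑-⟦≉⟧-unique xs !xs (∈-tail t∈))
    where
    ∈-tail : t ∈ x ∷ xs → t ∈ xs
    ∈-tail (here t≈x)   = contradiction (sym t≈x) x≉t
    ∈-tail (there t∈xs) = t∈xs

module _ {c ℓ : Level} (F : FiniteField c ℓ) where
  open FiniteField F
    renaming (_+_ to _⊕_; _*_ to _⊗_; refl to ≈-refl; sym to ≈-sym; trans to ≈-trans)
    hiding (zero)

  decSetoid : DecSetoid c ℓ
  decSetoid = record { isDecEquivalence = record { isEquivalence = isEquivalence ; _≟_ = _≟_ } }

  open Counting decSetoid
  open Data.List.Membership.Setoid setoid using (_∈_)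
  open Data.List.Relation.Unary.Unique.Setoid setoid using (Unique)

  -- Each field element occurs exactly once up to ≈, so Q is the size of the field.
  elements : List Carrier
  elements = deduplicate _≟_ (map enum (allFin q))

  Q : ℕ
  Q = length elements

  element : Fin Q → Carrier
  element = lookup elements

  elements-unique : Unique elements
  elements-unique = deduplicate-! decSetoid (map enum (allFin q))

  ∈-elements : ∀ t → t ∈ elements
  ∈-elements = deduplicate⁺ decSetoid ∈-enumeration
    where
    ∈-enumeration : ∀ t → t ∈ map enum (allFin q)
    ∈-enumeration t with i , enum-i≈t ← enum-surjective t =
      SetoidMembership.∈-resp-≈ setoid enum-i≈t
        (SetoidMembership.∈-map⁺ (≡.setoid (Fin q)) setoid (λ { refl → ≈-refl }) (∈-allFin i))

  affine-root : ∀ {a b h l} → (b ⊗ h) ≈ 1# → (a ⊕ (l ⊗ b)) ≈ 0# ⇔ l ≈ ((- a) ⊗ h)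
  affine-root {a} {b} {h} {l} bh≈1 = mk⇔ to from
    where
    open import Relation.Binary.Reasoning.Setoid setoid
    to : (a ⊕ (l ⊗ b)) ≈ 0# → l ≈ ((- a) ⊗ h)
    to root = begin
      l               ≈⟨ *-identityʳ l ⟨
      l ⊗ 1#          ≈⟨ *-congˡ bh≈1 ⟨
      l ⊗ (b ⊗ h)     ≈⟨ *-assoc l b h ⟨
      (l ⊗ b) ⊗ h     ≈⟨ *-congʳ lb≈-a ⟩
      (- a) ⊗ h       ∎
      where
      lb≈-a : (l ⊗ b) ≈ (- a)
      lb≈-a = begin
        l ⊗ b                 ≈⟨ +-identityˡ (l ⊗ b) ⟨
        0# ⊕ (l ⊗ b)          ≈⟨ +-congʳ (-‿inverseˡ a) ⟨
        ((- a) ⊕ a) ⊕ (l ⊗ b) ≈⟨ +-assoc (- a) a (l ⊗ b) ⟩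
        (- a) ⊕ (a ⊕ (l ⊗ b)) ≈⟨ +-congˡ root ⟩
        (- a) ⊕ 0#            ≈⟨ +-identityʳ (- a) ⟩
        - a                   ∎
    from : l ≈ ((- a) ⊗ h) → (a ⊕ (l ⊗ b)) ≈ 0#
    from l≈ = begin
      a ⊕ (l ⊗ b)               ≈⟨ +-congˡ (*-congʳ l≈) ⟩
      a ⊕ (((- a) ⊗ h) ⊗ b)     ≈⟨ +-congˡ (*-assoc (- a) h b) ⟩
      a ⊕ ((- a) ⊗ (h ⊗ b))     ≈⟨ +-congˡ (*-congˡ (≈-trans (*-comm h b) bh≈1)) ⟩
      a ⊕ ((- a) ⊗ 1#)          ≈⟨ +-congˡ (*-identityʳ (- a)) ⟩
      a ⊕ (- a)                 ≈⟨ -‿inverseʳ a ⟩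
      0#                        ∎

  ∑-affine-nonzero : ∀ a {b} → ¬ b ≈ 0# → (∑[ i < Q ] ⟦ a ⊕ (element i ⊗ b) ≉ 0# ⟧) + 1 ≡ Q
  ∑-affine-nonzero a {b} b≉0 with h , bh≈1 ← inverse b b≉0 = begin
    (∑[ i < Q ] ⟦ a ⊕ (element i ⊗ b) ≉ 0# ⟧) + 1
      ≡⟨ cong (_+ 1) (sum-cong-≗ λ i →
           cong (λ β → if β then 0 else 1) (does-⇔ (affine-root {a} {b} {h} {element i} bh≈1) (_ ≟ _) (_ ≟ _))) ⟩
    (∑[ i < Q ] ⟦ element i ≉ (- a) ⊗ h ⟧) + 1
      ≡⟨ ∑-⟦≉⟧-unique elements elements-unique (∈-elements ((- a) ⊗ h)) ⟩
    Q ∎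
    where open ≡-Reasoning

  +-absorbˡ : ∀ a l {b} → b ≈ 0# → (a ⊕ (l ⊗ b)) ≈ a
  +-absorbˡ a l b≈0 = ≈-trans (+-congˡ (≈-trans (*-congˡ b≈0) (zeroʳ l))) (+-identityʳ a)

  ∑-affine-zero : ∀ a {b} → b ≈ 0# → ∑[ i < Q ] ⟦ a ⊕ (element i ⊗ b) ≉ 0# ⟧ ≡ Q * ⟦ a ≉ 0# ⟧
  ∑-affine-zero a b≈0 =
    ≡.trans (sum-cong-≗ λ i → ⟦≉⟧-congˡ (+-absorbˡ a (element i) b≈0)) (∑-const Q ⟦ a ≉ 0# ⟧)

  translate-cancel : ∀ a l b → ((a ⊕ (l ⊗ b)) ⊕ ((- l) ⊗ b)) ≈ a
  translate-cancel a l b = begin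
    (a ⊕ (l ⊗ b)) ⊕ ((- l) ⊗ b) ≈⟨ +-assoc a (l ⊗ b) ((- l) ⊗ b) ⟩
    a ⊕ ((l ⊗ b) ⊕ ((- l) ⊗ b)) ≈⟨ +-congˡ (distribʳ b l (- l)) ⟨
    a ⊕ ((l ⊕ (- l)) ⊗ b)       ≈⟨ +-congˡ (≈-trans (*-congʳ (-‿inverseʳ l)) (zeroˡ b)) ⟩
    a ⊕ 0#                      ≈⟨ +-identityʳ a ⟩
    a                           ∎
    where open import Relation.Binary.Reasoning.Setoid setoid

  wt≡∑ : ∀ {n} (u : Word F n) → wt F u ≡ ∑[ x < n ] ⟦ u x ≉ 0# ⟧
  wt≡∑ {zero}  u = refl
  wt≡∑ {suc n} u = cong (⟦ u zero ≉ 0# ⟧ +_) (wt≡∑ (u ∘ suc))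

  Subset : ℕ → Set
  Subset n = Fin n → Bool

  ∅ : ∀ {n} → Subset n
  ∅ _ = false

  _∪supp_ : ∀ {n} → Subset n → Word F n → Subset n
  (S ∪supp g) x = S x ∨ not (does (g x ≟ 0#))

  _+[_]_ : ∀ {n} → Word F n → Carrier → Word F n → Word F n
  (v +[ l ] g) x = v x ⊕ (l ⊗ g x)

  nzOutside : ∀ {n} → Subset n → Word F n → Fin n → ℕ
  nzOutside S v x = if S x then 0 else ⟦ v x ≉ 0# ⟧

  wtOutside : ∀ {n} → Subset n → Word F n → ℕ
  wtOutside {n} S v = ∑[ x < n ] nzOutside S v x

  wtOutside≡0⇒ : ∀ {n} (S : Subset n) v → wtOutside S v ≡ 0 → ∀ x → nzOutside S v x ≡ 0
  wtOutside≡0⇒ S v = ∑≡0⇒ (nzOutside S v)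

  wt≡0⇒zero : ∀ {n} {v : Word F n} → wt F v ≡ 0 → ∀ x → v x ≈ 0#
  wt≡0⇒zero {v = v} wt≡0 x = ⟦≉⟧≡0⇒≈ (∑≡0⇒ _ (≡.trans (≡.sym (wt≡∑ v)) wt≡0) x)

  wtOutside≢0⇒nonzero : ∀ {n} (S : Subset n) v → wtOutside S v ≢ 0 → IsNonzero F v
  wtOutside≢0⇒nonzero S v ≢0 v≈0 = ≢0 (∑-zero vanishes)
    where
    vanishes : ∀ x → nzOutside S v x ≡ 0
    vanishes x with S x
    ... | true  = refl
    ... | false = ⟦≈⟧ (v≈0 x)

  nzOutside≢0⇒supp : ∀ {n} (S : Subset n) v x → nzOutside S v x ≢ 0 → ¬ v x ≈ 0#
  nzOutside≢0⇒supp S v x ≢0 v≈0 with S x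
  ... | true  = ≢0 refl
  ... | false = ≢0 (⟦≈⟧ v≈0)

  shared-coordinate⇒wtOutside≢0 : ∀ {n} (S : Subset n) u g x → nzOutside S u x ≢ 0 → ¬ g x ≈ 0# → wtOutside S g ≢ 0
  shared-coordinate⇒wtOutside≢0 S u g x u≢0 g≉0 wt≡0 = outside (wtOutside≡0⇒ S g wt≡0 x)
    where
    outside : nzOutside S g x ≢ 0
    outside with S x
    ... | true  = λ _ → u≢0 refl
    ... | false = λ eq → contradiction (≡.trans (≡.sym (⟦≉⟧ g≉0)) eq) λ ()

  nzOutside-∪supp : ∀ {n} (S : Subset n) v g x → nzOutside S v x ≡ 0 → nzOutside (S ∪supp g) v x ≡ 0
  nzOutside-∪supp S v g x eq with S x | g x ≟ 0#
  ... | true  | _     = refl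
  ... | false | yes _ = eq
  ... | false | no _  = refl

  nzOutside-∪supp-self : ∀ {n} (S : Subset n) v g x → ¬ g x ≈ 0# → nzOutside (S ∪supp g) v x ≡ 0
  nzOutside-∪supp-self S v g x g≉0 with S x | g x ≟ 0#
  ... | true  | _       = refl
  ... | false | yes g≈0 = contradiction g≈0 g≉0
  ... | false | no _    = refl

  nzOutside-∪supp-translate : ∀ {n} (S : Subset n) v l g x →
    nzOutside S (v +[ l ] g) x ≡ 0 → nzOutside (S ∪supp g) v x ≡ 0
  nzOutside-∪supp-translate S v l g x eq with S x | g x ≟ 0#
  ... | true  | _       = refl
  ... | false | yes g≈0 = ≡.trans (⟦≉⟧-congˡ (≈-sym (+-absorbˡ (v x) l g≈0))) eq
  ... | false | no _    = refl

  -- On a coordinate outside S where g vanishes every translate agrees with v; where g does not vanish,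
  -- exactly one of the Q translates vanishes.
  translates-count-at : ∀ {n} (S : Subset n) v g x →
    (∑[ i < Q ] nzOutside S (v +[ element i ] g) x) + nzOutside S g x
      ≡ Q * nzOutside S g x + Q * nzOutside (S ∪supp g) v x
  translates-count-at S v g x with S x | g x ≟ 0#
  ... | true  | _ rewrite ℕₚ.*-zeroʳ Q = cong (_+ 0) (∑-zero {Q} {λ _ → 0} λ _ → refl)
  ... | false | yes g≈0 rewrite ℕₚ.*-zeroʳ Q =
    ≡.trans (ℕₚ.+-identityʳ _) (∑-affine-zero (v x) g≈0)
  ... | false | no g≉0 rewrite ℕₚ.*-zeroʳ Q | ℕₚ.*-identityʳ Q | ℕₚ.+-identityʳ Q =
    ∑-affine-nonzero (v x) g≉0

  translates-count : ∀ {n} (S : Subset n) v g →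
    (∑[ i < Q ] wtOutside S (v +[ element i ] g)) + wtOutside S g
      ≡ Q * wtOutside S g + Q * wtOutside (S ∪supp g) v
  translates-count {n} S v g = begin
    (∑[ i < Q ] ∑[ x < n ] nzOutside S (v +[ element i ] g) x) + wtOutside S g
      ≡⟨ cong (_+ wtOutside S g) (∑-comm (λ i x → nzOutside S (v +[ element i ] g) x)) ⟩
    (∑[ x < n ] ∑[ i < Q ] nzOutside S (v +[ element i ] g) x) + wtOutside S g
      ≡⟨ ∑-distrib-+ (λ x → ∑[ i < Q ] nzOutside S (v +[ element i ] g) x) (nzOutside S g) ⟨
    ∑[ x < n ] ((∑[ i < Q ] nzOutside S (v +[ element i ] g) x) + nzOutside S g x)
      ≡⟨ sum-cong-≗ (translates-count-at S v g) ⟩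
    ∑[ x < n ] (Q * nzOutside S g x + Q * nzOutside (S ∪supp g) v x)
      ≡⟨ ∑-distrib-+ (λ x → Q * nzOutside S g x) (λ x → Q * nzOutside (S ∪supp g) v x) ⟩
    (∑[ x < n ] (Q * nzOutside S g x)) + (∑[ x < n ] (Q * nzOutside (S ∪supp g) v x))
      ≡⟨ cong₂ _+_ (*-distribˡ-sum Q (nzOutside S g)) (*-distribˡ-sum Q (nzOutside (S ∪supp g) v)) ⟨
    Q * wtOutside S g + Q * wtOutside (S ∪supp g) v ∎
    where open ≡-Reasoning

  module Rigidity {ℓc ℓd : Level} {n : ℕ} (C : Word F n → Set ℓc) (C′ : Word F n → Set ℓd)
      (lin : IsLinearCode F C) (cw : IsConstantWeight F C) (sub : IsSubcode F C′ C) where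
    open IsLinearCode lin using (+-closed; ·-closed)
    open IsSubcode sub using (⊆C; linear)
    module C′ = IsLinearCode linear

    -- S plays the role of Supp D for the k-dimensional subcode D ⊆ C′ spanned by the codewords chosen so far.
    record Rigid (S : Subset n) (k : ℕ) : Set (c ⊔ ℓ ⊔ ℓc ⊔ ℓd) where
      field
        ∈C′   : ∀ {v} → C v → wtOutside S v ≡ 0 → C′ v
        scale : ∀ {v} → C v → wtOutside S v ≢ 0 → wtOutside S v * Q ^ k ≡ wt F v

    rigid-∅ : Rigid ∅ 0
    rigid-∅ = record
      { ∈C′   = λ {v} _ wt≡0 → C′.respects (λ x → ≈-sym (⟦≉⟧≡0⇒≈ (wtOutside≡0⇒ ∅ v wt≡0 x))) C′.zero∈
      ; scale = λ {v} _ _ → ≡.trans (ℕₚ.*-identityʳ _) (≡.sym (wt≡∑ v))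
      }

    module Extend {S : Subset n} {k : ℕ} {g : Word F n}
        (R : Rigid S k) (C′g : C′ g) (g∉S : wtOutside S g ≢ 0) where
      open Rigid R

      Cg : C g
      Cg = ⊆C C′g

      g≢0 : IsNonzero F g
      g≢0 = wtOutside≢0⇒nonzero S g g∉S

      C-translate : ∀ {v} l → C v → C (v +[ l ] g)
      C-translate l Cv = +-closed Cv (·-closed l Cg)

      ∈C′-of-vanishing-translate : ∀ {v} l → C v → wtOutside S (v +[ l ] g) ≡ 0 →
                 C′ v × wtOutside (S ∪supp g) v ≡ 0
      ∈C′-of-vanishing-translate {v} l Cv wt≡0 =
          C′.respects (λ x → translate-cancel (v x) l (g x))
            (C′.+-closed (∈C′ (C-translate l Cv) wt≡0) (C′.·-closed (- l) C′g))
        , ∑-zero (λ x → nzOutside-∪supp-translate S v l g x (wtOutside≡0⇒ S (v +[ l ] g) wt≡0 x))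

      scale-of-nonvanishing-translates : ∀ {v} → C v → (∀ i → wtOutside S (v +[ element i ] g) ≢ 0) →
                wtOutside (S ∪supp g) v * Q ^ suc k ≡ wt F g
      scale-of-nonvanishing-translates {v} Cv translates≢0 = ≡.sym (ℕₚ.+-cancelˡ-≡ (Q * W) W (T * Q ^ suc k) (begin
        Q * W + W
          ≡⟨ cong₂ _+_ (∑-const Q W) hg ⟨
        (∑[ i < Q ] W) + wtOutside S g * K
          ≡⟨ cong (_+ wtOutside S g * K) (sum-cong-≗ translate-scale) ⟨
        (∑[ i < Q ] (wtOutside S (v +[ element i ] g) * K)) + wtOutside S g * K
          ≡⟨ cong (_+ wtOutside S g * K) (*-distribʳ-sum K (λ i → wtOutside S (v +[ element i ] g))) ⟨
        (∑[ i < Q ] wtOutside S (v +[ element i ] g)) * K + wtOutside S g * K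
          ≡⟨ ℕₚ.*-distribʳ-+ K (∑[ i < Q ] wtOutside S (v +[ element i ] g)) (wtOutside S g) ⟨
        ((∑[ i < Q ] wtOutside S (v +[ element i ] g)) + wtOutside S g) * K
          ≡⟨ cong (_* K) (translates-count S v g) ⟩
        (Q * wtOutside S g + Q * T) * K
          ≡⟨ ℕₚ.*-distribʳ-+ K (Q * wtOutside S g) (Q * T) ⟩
        Q * wtOutside S g * K + Q * T * K
          ≡⟨ cong₂ _+_ (≡.trans (ℕₚ.*-assoc Q (wtOutside S g) K) (cong (Q *_) hg))
                       (≡.trans (cong (_* K) (ℕₚ.*-comm Q T)) (ℕₚ.*-assoc T Q K)) ⟩
        Q * W + T * Q ^ suc k ∎))
        where
        open ≡-Reasoning
        W = wt F g
        K = Q ^ k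
        T = wtOutside (S ∪supp g) v
        hg : wtOutside S g * K ≡ W
        hg = scale Cg g∉S
        translate-scale : ∀ i → wtOutside S (v +[ element i ] g) * K ≡ W
        translate-scale i = ≡.trans (scale (C-translate (element i) Cv) (translates≢0 i))
          (cw (C-translate (element i) Cv) Cg (wtOutside≢0⇒nonzero S _ (translates≢0 i)) g≢0)

      dichotomy : ∀ {v} → C v →
        (C′ v × wtOutside (S ∪supp g) v ≡ 0) ⊎ (wtOutside (S ∪supp g) v * Q ^ suc k ≡ wt F g)
      dichotomy {v} Cv with any? (λ i → wtOutside S (v +[ element i ] g) ℕ.≟ 0)
      ... | yes (i , wt≡0) = inj₁ (∈C′-of-vanishing-translate (element i) Cv wt≡0)
      ... | no none        = inj₂ (scale-of-nonvanishing-translates Cv λ i wt≡0 → none (i , wt≡0))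

      rigid-extend : Rigid (S ∪supp g) (suc k)
      rigid-extend = record { ∈C′ = ∈C′-extend ; scale = scale-extend }
        where
        ∈C′-extend : ∀ {v} → C v → wtOutside (S ∪supp g) v ≡ 0 → C′ v
        ∈C′-extend Cv T≡0 with dichotomy Cv
        ... | inj₁ (C′v , _) = C′v
        ... | inj₂ eq = contradiction (wt≡0⇒zero (≡.trans (≡.sym eq) (cong (_* _) T≡0))) g≢0
        scale-extend : ∀ {v} → C v → wtOutside (S ∪supp g) v ≢ 0 → wtOutside (S ∪supp g) v * Q ^ suc k ≡ wt F v
        scale-extend Cv T≢0 with dichotomy Cv
        ... | inj₁ (_ , T≡0) = contradiction T≡0 T≢0
        ... | inj₂ eq = ≡.trans eq (cw Cg Cv g≢0 (wtOutside≢0⇒nonzero (S ∪supp g) _ T≢0))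

    open Extend using (rigid-extend)

    cover : ∀ {u} → (∀ x → Supp F u x → SuppCode F C′ x) → (xs : List (Fin n)) →
            Σ (Subset n) λ S → Σ ℕ λ k → Rigid S k × All (λ x → nzOutside S u x ≡ 0) xs
    cover supp⊆ [] = ∅ , 0 , rigid-∅ , []
    cover {u} supp⊆ (x ∷ xs) with cover supp⊆ xs
    ... | S , k , R , covered with nzOutside S u x ℕ.≟ 0
    ...   | yes ux≡0 = S , k , R , ux≡0 ∷ covered
    ...   | no ux≢0 with g , C′g , gx≉0 ← supp⊆ x (nzOutside≢0⇒supp S u x ux≢0) =
      S ∪supp g , suc k , rigid-extend R C′g (shared-coordinate⇒wtOutside≢0 S u g x ux≢0 gx≉0)
      , nzOutside-∪supp-self S u g x gx≉0 ∷ All.map (nzOutside-∪supp S u g _) covered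

    supp⊆⇒∈C′ : ∀ {u} → C u → (∀ x → Supp F u x → SuppCode F C′ x) → C′ u
    supp⊆⇒∈C′ Cu supp⊆ with S , k , R , covered ← cover supp⊆ (allFin n) =
      Rigid.∈C′ R Cu (∑-zero λ x → All.lookup covered (∈-allFin x))

lemma2 : {c ℓ ℓc ℓd : Level} (F : FiniteField c ℓ) {n : ℕ}
    (C : Word F n → Set ℓc) (C′ : Word F n → Set ℓd) →
    IsLinearCode F C → IsConstantWeight F C → IsSubcode F C′ C →
    (u : Word F n) → C u →
    (C′ u → (∀ x → Supp F u x → SuppCode F C′ x)) × ((∀ x → Supp F u x → SuppCode F C′ x) → C′ u)
lemma2 F C C′ lin cw sub u Cu =
  (λ C′u x ux≉0 → u , C′u , ux≉0) , Rigidity.supp⊆⇒∈C′ F C C′ lin cw sub Cu
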